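{- If a chordal graph $G$ has a $[\lambda,C]$-partition then it has a $[\lambda,C]$-coloring.
   Context: A graph is chordal if every cycle of length at least four has a chord. A $[\lambda,C]$-coloring of $G=(V,E)$ is a map from $V$ to a set of $\lambda$ colors (adjacent vertices may share a color) such that every connected component of the subgraph induced by a single color class has at most $C$ vertices. A $[\lambda,C]$-partition of $G$ is a partition $\{P_1,\dots,P_t\}$ of $V$ such that each induced subgraph $G[P_i]$ is connected, each $|P_i|\le C$, and every clique of $G$ intersects at most $\lambda$ of the parts. -}

module Defs where

open import Data.Nat using (ℕ; zero; suc; _≤_)
open import Data.Fin using (Fin; toℕ)
open import Data.List using (List; length; map)
open import Data.List.Relation.Unary.All using (All)
open import Data.List.Relation.Unary.AllPairs using (AllPairs)
open import Data.List.Relation.Unary.Unique.Propositional using (Unique)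
open import Data.List.Membership.Propositional using (_∈_)
open import Data.Product using (Σ; _×_; ∃; ∃-syntax)
open import Data.Sum using (_⊎_)
open import Relation.Nullary using (¬_)
open import Relation.Binary.PropositionalEquality using (_≡_; _≢_)
open import Relation.Binary using (Decidable)
open import Function.Definitions using (Injective)

record Graph (n : ℕ) : Set₁ where
  field
    Adj    : Fin n → Fin n → Set
    adj?   : Decidable Adj
    sym    : ∀ {u v} → Adj u v → Adj v u
    irrefl : ∀ {u} → ¬ Adj u u

module _ {n : ℕ} (G : Graph n) where
  open Graph G

  Consecutive : (k : ℕ) → Fin k → Fin k → Set
  Consecutive k i j =
      suc (toℕ i) ≡ toℕ j
    ⊎ suc (toℕ j) ≡ toℕ i
    ⊎ (toℕ i ≡ 0 × suc (toℕ j) ≡ k)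
    ⊎ (toℕ j ≡ 0 × suc (toℕ i) ≡ k)

  IsCycle : (k : ℕ) → (Fin k → Fin n) → Set
  IsCycle k c = Injective _≡_ _≡_ c × (∀ i j → Consecutive k i j → Adj (c i) (c j))

  HasChord : (k : ℕ) → (Fin k → Fin n) → Set
  HasChord k c = ∃[ i ] ∃[ j ] (Adj (c i) (c j) × ¬ Consecutive k i j)

  Chordal : Set
  Chordal = ∀ (m : ℕ) (c : Fin (suc (suc (suc (suc m)))) → Fin n) →
            IsCycle (suc (suc (suc (suc m)))) c → HasChord (suc (suc (suc (suc m)))) c

  data Reach (S : Fin n → Set) : Fin n → Fin n → Set where
    here : ∀ {u} → S u → Reach S u u
    step : ∀ {u v w} → Reach S u v → Adj v w → S w → Reach S u w

  AtMost : (Fin n → Set) → ℕ → Set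
  AtMost S C = ∀ (xs : List (Fin n)) → Unique xs → All S xs → length xs ≤ C

  IsClique : List (Fin n) → Set
  IsClique K = Unique K × AllPairs Adj K

  IsColoring : (λ' C : ℕ) → (Fin n → Fin λ') → Set
  IsColoring λ' C col =
    ∀ (v : Fin n) → AtMost (λ u → Reach (λ w → col w ≡ col v) v u) C

  -- [λ,C]-partition, parts given as the fibres of a labelling p : V → ℕ
  -- (part P_v = { u | p u ≡ p v }).
  IsPartition : (λ' C : ℕ) → (Fin n → ℕ) → Set
  IsPartition λ' C p =
      (∀ u v → p u ≡ p v → Reach (λ w → p w ≡ p u) u v)
    × (∀ v → AtMost (λ u → p u ≡ p v) C)
    × (∀ (K : List (Fin n)) → IsClique K →
         ∀ (ls : List ℕ) → Unique ls → All (_∈ map p K) ls → length ls ≤ λ')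

  HasPartition : (λ' C : ℕ) → Set
  HasPartition λ' C = Σ (Fin n → ℕ) (IsPartition λ' C)

  HasColoring : (λ' C : ℕ) → Set
  HasColoring λ' C = Σ (Fin n → Fin λ') (IsColoring λ' C)

-- Colour the vertices faithfully to the partition: constantly on every part, and differently
-- on adjacent vertices of different parts.  Then a monochromatic path never leaves a part, so
-- every monochromatic component lies in one part and has at most C vertices.
--
-- A faithful colouring with λ colours is built by peeling off a simplicial vertex s (one whose
-- neighbours are pairwise adjacent): colour the rest faithfully (parts stay connected, since
-- paths through s can bypass it), then give s the colour of its part if that part has other
-- vertices, and otherwise a colour not used on its neighbours.  Such a colour exists, since s
-- with one neighbour of each colour would be a clique meeting λ + 1 parts.
--
-- Simplicial vertices exist by Dirac's lemma: every induced subgraph of a chordal graph is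
-- complete or has two non-adjacent simplicial vertices.  It is proved by induction over vertex
-- subsets (Data.Fin.Subset, well-founded under ⊂), using components and the fact that a chordal
-- graph has no hole: no vertex a has two non-adjacent neighbours joined by a path avoiding the
-- closed neighbourhood of a (module Holes, via shortest "arcs" around a).
module Submission where

open import Defs
open import Data.Nat using (ℕ; zero; suc; _+_; _≤_; _<_; z≤n; s≤s; _<?_; _≤?_; _≟_)
open import Data.Nat.Properties
open import Data.Nat.Induction using (<-rec)
open import Data.Nat.Tactic.RingSolver using (solve-∀)
open import Data.Bool using (true)
open import Data.Fin using (Fin; toℕ; zero; suc; fromℕ<)
open import Data.Fin.Properties using (toℕ-injective; toℕ<n; any?; all?; ¬∀⟶∃¬) renaming (_≟_ to _≟ᶠ_)
open import Data.Fin.Subset using (Subset; ⊤; _∈_; _∉_; _⊆_; _⊂_; _∪_; _∩_; _-_; ⁅_⁆)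
open import Data.Fin.Subset.Properties using (_∈?_; ∈⊤; x∈p∩q⁺; x∈p∩q⁻; x∈⁅x⁆; x∈⁅y⁆⇒x≡y; x∈p∧x≢y⇒x∈p-y; p─q⊆p; x∈p⇒p-x⊂p; x∈p∪q⁺; x∈p∪q⁻; p⊆p∪q; nonempty?)
open import Data.Fin.Subset.Induction using (⊂-wellFounded; ⊃-wellFounded)
open import Data.Vec using (_∷_; tabulate; there)
open import Data.Vec.Properties using (lookup∘tabulate; []=⇒lookup; lookup⇒[]=)
open import Data.List using (List; []; _∷_; length; map) renaming (tabulate to tabulateₗ)
open import Data.List.Properties using (length-tabulate)
open import Data.List.Relation.Unary.Any using (here; there)
open import Data.List.Relation.Unary.All as All using (All; []; _∷_)
open import Data.List.Relation.Unary.AllPairs using ([]; _∷_)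
open import Data.List.Relation.Unary.Unique.Propositional using (Unique)
open import Data.List.Membership.Propositional using () renaming (_∈_ to _∈ₗ_)
open import Data.List.Membership.Propositional.Properties using (∈-map⁺; ∈-tabulate⁺)
import Data.List.Relation.Unary.All.Properties as Allₚ
import Data.List.Relation.Unary.AllPairs.Properties as AllPairsₚ
import Data.List.Relation.Unary.Unique.Propositional.Properties as Uniqueₚ
open import Data.Product using (_×_; ∃-syntax; _,_; proj₁; proj₂)
open import Data.Sum using (_⊎_; inj₁; inj₂)
open import Data.Empty using (⊥; ⊥-elim)
open import Function using (_∘_)
open import Induction.WellFounded as WF using ()
open import Relation.Nullary using (¬_; Dec; yes; no; contradiction; does; ¬?; _×-dec_; _⊎-dec_)
open import Relation.Nullary.Decidable using (dec-true; decidable-stable)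
open import Relation.Unary using (Decidable)
open import Relation.Binary using (tri<; tri≈; tri>)
open import Relation.Binary.PropositionalEquality

⟦_⟧ : ∀ {n} {P : Fin n → Set} → Decidable P → Subset n
⟦ P? ⟧ = tabulate (λ v → does (P? v))

module _ {n} {P : Fin n → Set} (P? : Decidable P) where

  ∈⟦⟧⁺ : ∀ {v} → P v → v ∈ ⟦ P? ⟧
  ∈⟦⟧⁺ {v} pv = lookup⇒[]= v _ (trans (lookup∘tabulate _ v) (dec-true (P? v) pv))

  ∈⟦⟧⁻ : ∀ {v} → v ∈ ⟦ P? ⟧ → P v
  ∈⟦⟧⁻ {v} v∈ = witness (P? v) (trans (sym (lookup∘tabulate _ v)) ([]=⇒lookup v∈))
    where
    witness : ∀ {A : Set} (a? : Dec A) → does a? ≡ true → A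
    witness (yes a) _ = a

x∉p-x : ∀ {n} (p : Subset n) x → x ∉ p - x
x∉p-x (_ ∷ p) zero    ()
x∉p-x (_ ∷ p) (suc x) (there x∈) = x∉p-x p x x∈

module _ {n : ℕ} where

  x∈p-y⇒x≢y : ∀ {p : Subset n} {x y} → x ∈ p - y → x ≢ y
  x∈p-y⇒x≢y {p} x∈ refl = x∉p-x p _ x∈

  x∈p-y⇒x∈p : ∀ {p : Subset n} {x y} → x ∈ p - y → x ∈ p
  x∈p-y⇒x∈p {p} {y = y} = p─q⊆p p ⁅ y ⁆

module Paths {n : ℕ} (G : Graph n) where
  open Graph G renaming (sym to adj-sym)

  reach-end : ∀ {Q u v} → Reach G Q u v → Q v
  reach-end (here q)     = q
  reach-end (step _ _ q) = q

  reach-mono : ∀ {Q Q' : Fin n → Set} → (∀ {w} → Q w → Q' w) →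
               ∀ {u v} → Reach G Q u v → Reach G Q' u v
  reach-mono Q⊆Q' (here q)     = here (Q⊆Q' q)
  reach-mono Q⊆Q' (step r e q) = step (reach-mono Q⊆Q' r) e (Q⊆Q' q)

  reach-cons : ∀ {Q u v w} → Q u → Adj u v → Reach G Q v w → Reach G Q u w
  reach-cons qu e (here q)      = step (here qu) e q
  reach-cons qu e (step r e' q) = step (reach-cons qu e r) e' q

  reach-sym : ∀ {Q u v} → Reach G Q u v → Reach G Q v u
  reach-sym (here q)     = here q
  reach-sym (step r e q) = reach-cons q (adj-sym e) (reach-sym r)

  reach-trans : ∀ {Q u v w} → Reach G Q u v → Reach G Q v w → Reach G Q u w
  reach-trans r (here _)      = r
  reach-trans r (step r' e q) = step (reach-trans r r') e q

  record Walk (Q : Fin n → Set) (u v : Fin n) : Set where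
    field
      len    : ℕ
      at     : ℕ → Fin n
      start  : at 0 ≡ u
      end    : at len ≡ v
      inside : ∀ k → k ≤ len → Q (at k)
      steps  : ∀ k → k < len → Adj (at k) (at (suc k))

  -- Prepending a vertex is definitional on positions, so paths are converted back to front.
  cons : ∀ {Q u v w} → Q u → Adj u v → Walk Q v w → Walk Q u w
  cons {Q} {u} qu e W = record
    { len = suc len ; at = at′ ; start = refl ; end = end ; inside = inside′ ; steps = steps′ }
    where
    open Walk W
    at′ : ℕ → Fin n
    at′ zero    = u
    at′ (suc k) = at k
    inside′ : ∀ k → k ≤ suc len → Q (at′ k)
    inside′ zero    _       = qu
    inside′ (suc k) (s≤s k≤) = inside k k≤
    steps′ : ∀ k → k < suc len → Adj (at′ k) (at′ (suc k))
    steps′ zero    _         = subst (Adj u) (sym start) e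
    steps′ (suc k) (s≤s k<)  = steps k k<

  walk-back : ∀ {Q u v} → Reach G Q v u → Walk Q u v
  walk-back {v = v} (here q) =
    record { len = 0 ; at = λ _ → v ; start = refl ; end = refl ; inside = λ _ _ → q ; steps = λ _ () }
  walk-back (step r e q) = cons q (adj-sym e) (walk-back r)

  reach⇒walk : ∀ {Q u v} → Reach G Q u v → Walk Q u v
  reach⇒walk r = walk-back (reach-sym r)

  last-step : ∀ {Q u v} → Reach G Q u v → u ≢ v → ∃[ x ] (Q x × Adj x v)
  last-step (here _)     u≢u = ⊥-elim (u≢u refl)
  last-step (step r e _) _   = _ , reach-end r , e

  bypass′ : ∀ {Q s} → (∀ {x y} → Q x → Q y → Adj s x → Adj s y → x ≢ y → Adj x y) →
    ∀ {u v} → Reach G Q u v → u ≢ s →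
    Reach G (λ w → Q w × w ≢ s) u v ⊎ (v ≡ s × ∃[ x ] (Reach G (λ w → Q w × w ≢ s) u x × Adj s x))
  bypass′ clique (here q) u≢s = inj₁ (here (q , u≢s))
  bypass′ {s = s} clique (step {v = v} {w} r e q) u≢s with bypass′ clique r u≢s | w ≟ᶠ s
  ... | inj₁ r′ | yes refl = inj₂ (refl , v , r′ , adj-sym e)
  ... | inj₁ r′ | no  w≢s  = inj₁ (step r′ e (q , w≢s))
  ... | inj₂ (refl , x , r′ , s~x) | _ with w ≟ᶠ x
  ...   | yes refl = inj₁ r′
  ...   | no  w≢x  = inj₁ (step r′ (clique (proj₁ (reach-end r′)) q s~x e (w≢x ∘ sym)) (q , w≢s))
    where
    w≢s : w ≢ s
    w≢s refl = irrefl e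

  bypass : ∀ {Q s} → (∀ {x y} → Q x → Q y → Adj s x → Adj s y → x ≢ y → Adj x y) →
    ∀ {u v} → Reach G Q u v → u ≢ s → v ≢ s → Reach G (λ w → Q w × w ≢ s) u v
  bypass clique r u≢s v≢s with bypass′ clique r u≢s
  ... | inj₁ r′          = r′
  ... | inj₂ (v≡s , _) = ⊥-elim (v≢s v≡s)

-- Index arithmetic for deleting the block of positions a … a+d from a walk of length a + suc d + r.
block-shift : ∀ a d r → a + r + suc d ≡ a + suc d + r
block-shift = solve-∀

block-start : ∀ a d r → a ≤ a + suc d + r
block-start a d r = ≤-trans (m≤m+n a (suc d)) (m≤m+n (a + suc d) r)

-- Chordality forbids arcs (induced paths closing a hole around a vertex).
module Holes {n : ℕ} (G : Graph n) (chordal : Chordal G) where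
  open Graph G renaming (sym to adj-sym)
  open Paths G using (Walk)

  -- Together with z it closes up
  -- to a cycle of length L + 2 all of whose possible chords join two vertices of the walk.
  record Arc (z : Fin n) (L : ℕ) (f : ℕ → Fin n) : Set where
    field
      steps       : ∀ k → k < L → Adj (f k) (f (suc k))
      z-start     : Adj z (f 0)
      z-end       : Adj z (f L)
      z-inner     : ∀ k → 0 < k → k < L → ¬ Adj z (f k)
      avoids-z    : ∀ k → k ≤ L → f k ≢ z
      ends-nonadj : ¬ Adj (f 0) (f L)
      ends-differ : f 0 ≢ f L

  -- The walk f with the positions a … a+d deleted.
  splice : ℕ → ℕ → (ℕ → Fin n) → ℕ → Fin n
  splice a d f k with k <? a
  ... | yes _ = f k
  ... | no  _ = f (k + suc d)

  splice-< : ∀ a d f {k} → k < a → splice a d f k ≡ f k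
  splice-< a d f {k} k<a with k <? a
  ... | yes _   = refl
  ... | no  k≮a = contradiction k<a k≮a

  splice-≥ : ∀ a d f {k} → a ≤ k → splice a d f k ≡ f (k + suc d)
  splice-≥ a d f {k} a≤k with k <? a
  ... | yes k<a = contradiction a≤k (<⇒≱ k<a)
  ... | no  _   = refl

  -- The deletion leaves a walk iff the vertices on both sides of the gap are joined
  -- (for a block at the very start: iff the new first vertex is the old one).
  Rejoins : (ℕ → Fin n) → ℕ → ℕ → Set
  Rejoins f zero    d = f (suc d) ≡ f 0
  Rejoins f (suc a) d = Adj (f a) (f (suc a + suc d))

  splice-origin : ∀ a d r f k → k ≤ a + r →
    ∃[ k' ] (k' ≤ a + suc d + r × (0 < k → 0 < k') × (k < a + r → k' < a + suc d + r)
             × splice a d f k ≡ f k')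
  splice-origin a d r f k k≤ with k <? a
  ... | yes k<a = k , ≤-trans (<⇒≤ k<a) (block-start a d r) , (λ 0<k → 0<k)
                  , (λ _ → <-≤-trans k<a (block-start a d r)) , refl
  ... | no  _   = k + suc d , shift-≤ k≤ , (λ _ → subst (0 <_) (sym (+-suc k d)) (s≤s z≤n)) , shift-< , refl
    where
    shift-≤ : ∀ {k} → k ≤ a + r → k + suc d ≤ a + suc d + r
    shift-≤ {k} le = subst (k + suc d ≤_) (block-shift a d r) (+-monoˡ-≤ (suc d) le)
    shift-< : ∀ {k} → k < a + r → k + suc d < a + suc d + r
    shift-< = shift-≤

  splice-start : ∀ a d f → Rejoins f a d → splice a d f 0 ≡ f 0
  splice-start zero    d f join = trans (splice-≥ 0 d f {0} z≤n) join
  splice-start (suc a) d f _    = splice-< (suc a) d f (s≤s z≤n)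

  splice-end : ∀ a d r f → splice a d f (a + r) ≡ f (a + suc d + r)
  splice-end a d r f = trans (splice-≥ a d f (m≤m+n a r)) (cong f (block-shift a d r))

  splice-step : ∀ a d r f → (∀ k → k < a + suc d + r → Adj (f k) (f (suc k))) → Rejoins f a d →
                ∀ k → k < a + r → Adj (splice a d f k) (splice a d f (suc k))
  splice-step a d r f steps join k k< with <-cmp (suc k) a
  ... | tri< sk<a _ _ = subst₂ Adj (sym (splice-< a d f (<-trans (n<1+n k) sk<a))) (sym (splice-< a d f sk<a))
                          (steps k (<-≤-trans (<-trans (n<1+n k) sk<a) (block-start a d r)))
  ... | tri≈ _ refl _ = subst₂ Adj (sym (splice-< (suc k) d f (n<1+n k))) (sym (splice-≥ (suc k) d f ≤-refl)) join
  ... | tri> _ _ a<sk = subst₂ Adj (sym (splice-≥ a d f a≤k)) (sym (splice-≥ a d f (m≤n⇒m≤1+n a≤k)))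
                          (steps (k + suc d) (subst (k + suc d <_) (block-shift a d r) (+-monoˡ-< (suc d) k<)))
    where
    a≤k : a ≤ k
    a≤k = ≤-pred a<sk

  splice-arc : ∀ {z} a d r f → Arc z (a + suc d + r) f → Rejoins f a d → Arc z (a + r) (splice a d f)
  splice-arc {z} a d r f A join = record
    { steps       = splice-step a d r f steps join
    ; z-start     = subst (Adj z) (sym start) z-start
    ; z-end       = subst (Adj z) (sym end) z-end
    ; z-inner     = z-inner′
    ; avoids-z    = avoids-z′
    ; ends-nonadj = subst₂ (λ u v → ¬ Adj u v) (sym start) (sym end) ends-nonadj
    ; ends-differ = subst₂ _≢_ (sym start) (sym end) ends-differ
    }
    where
    open Arc A
    start = splice-start a d f join
    end   = splice-end a d r f
    z-inner′ : ∀ k → 0 < k → k < a + r → ¬ Adj z (splice a d f k)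
    z-inner′ k 0<k k< with splice-origin a d r f k (<⇒≤ k<)
    ... | k' , _ , interior₀ , interior₁ , eq =
      subst (λ v → ¬ Adj z v) (sym eq) (z-inner k' (interior₀ 0<k) (interior₁ k<))
    avoids-z′ : ∀ k → k ≤ a + r → splice a d f k ≢ z
    avoids-z′ k k≤ with splice-origin a d r f k k≤
    ... | k' , k'≤ , _ , _ , eq = subst (_≢ z) (sym eq) (avoids-z k' k'≤)

  ShorterArc : Fin n → ℕ → Set
  ShorterArc z L = ∃[ L' ] ∃[ f ] (L' < L × Arc z L' f)

  splice-shortens : ∀ {z} a d r f → Arc z (a + suc d + r) f → Rejoins f a d → ShorterArc z (a + suc d + r)
  splice-shortens a d r f A join =
    a + r , splice a d f , subst (a + r <_) (block-shift a d r) (m<m+n (a + r) (s≤s z≤n)) , splice-arc a d r f A join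

  block : ∀ {i j L} → i < j → j ≤ L → ∃[ d ] ∃[ r ] (j ≡ i + suc d × L ≡ i + suc d + r)
  block {i} i<j j≤L with m≤n⇒∃[o]m+o≡n i<j | m≤n⇒∃[o]m+o≡n j≤L
  ... | d , refl | r , refl = d , r , sym (+-suc i d) , cong (_+ r) (sym (+-suc i d))

  repeat-shortens : ∀ {z L f i j} → Arc z L f → i < j → j ≤ L → f i ≡ f j → ShorterArc z L
  repeat-shortens {z} {f = f} {i} A i<j j≤L eq with block i<j j≤L
  ... | d , r , refl , refl = splice-shortens i d r f A (rejoins i A eq)
    where
    rejoins : ∀ i → Arc z (i + suc d + r) f → f i ≡ f (i + suc d) → Rejoins f i d
    rejoins zero    _ eq = sym eq
    rejoins (suc a) A eq = subst (Adj (f a)) eq (Arc.steps A a (block-start (suc a) d r))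

  close : Fin n → (ℕ → Fin n) → ℕ → Fin n
  close z f zero    = z
  close z f (suc k) = f k

  -- A chord of the closed-up cycle either contradicts the arc conditions (chords at z)
  -- or is a shortcut of the walk.
  chord-shortens : ∀ {z L f} → Arc z L f → ∀ a b → a < b → b ≤ suc L →
    Adj (close z f a) (close z f b) → suc a ≢ b → ¬ (a ≡ 0 × b ≡ suc L) → ShorterArc z L
  chord-shortens A zero (suc b) _ b≤ e not-next not-wrap =
    ⊥-elim (Arc.z-inner A b 0<b (≤∧≢⇒< (≤-pred b≤) (λ b≡L → not-wrap (refl , cong suc b≡L))) e)
    where
    0<b : 0 < b
    0<b = ≤∧≢⇒< z≤n (λ 0≡b → not-next (cong suc 0≡b))
  chord-shortens {f = f} A (suc a) (suc b) a<b b≤ e not-next _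
    with block (≤∧≢⇒< (≤-pred a<b) (λ sa≡b → not-next (cong suc sa≡b))) (≤-pred b≤)
  ... | d , r , refl , refl = splice-shortens (suc a) d r f A e

  Repeats : (ℕ → Fin n) → ℕ → Set
  Repeats f L = ∃[ j ] (j < suc L × ∃[ i ] (i < j × f i ≡ f j))

  repeats? : ∀ f L → Dec (Repeats f L)
  repeats? f L = anyUpTo? (λ j → anyUpTo? (λ i → f i ≟ᶠ f j) j) (suc L)

  close-injective : ∀ {z L f} → Arc z L f → ¬ Repeats f L →
    ∀ i j → i ≤ suc L → j ≤ suc L → close z f i ≡ close z f j → i ≡ j
  close-injective A _ zero    zero    _ _ _ = refl
  close-injective A _ zero    (suc j) _ j≤ e = ⊥-elim (Arc.avoids-z A j (≤-pred j≤) (sym e))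
  close-injective A _ (suc i) zero    i≤ _ e = ⊥-elim (Arc.avoids-z A i (≤-pred i≤) e)
  close-injective A no-repeat (suc i) (suc j) i≤ j≤ e with <-cmp i j
  ... | tri< i<j _ _ = ⊥-elim (no-repeat (j , j≤ , i , i<j , e))
  ... | tri≈ _ i≡j _ = cong suc i≡j
  ... | tri> _ _ j<i = ⊥-elim (no-repeat (i , i≤ , j , j<i , sym e))

  position≤ : ∀ {L} (i : Fin (suc (suc L))) → toℕ i ≤ suc L
  position≤ i = ≤-pred (toℕ<n i)

  arc-cycle : ∀ {z L f} → Arc z L f → ¬ Repeats f L → IsCycle G (suc (suc L)) (λ i → close z f (toℕ i))
  arc-cycle {z} {L} {f} A no-repeat = injective , consecutive-adjacent
    where
    open Arc A
    injective : ∀ {i j} → close z f (toℕ i) ≡ close z f (toℕ j) → i ≡ j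
    injective {i} {j} e = toℕ-injective (close-injective A no-repeat (toℕ i) (toℕ j) (position≤ i) (position≤ j) e)
    next : ∀ a b → suc a ≡ b → b ≤ suc L → Adj (close z f a) (close z f b)
    next zero    .1               refl _  = z-start
    next (suc a) .(suc (suc a))   refl b≤ = steps a (≤-pred b≤)
    wrap : ∀ a b → a ≡ 0 → suc b ≡ suc (suc L) → Adj (close z f a) (close z f b)
    wrap .0 .(suc L) refl refl = z-end
    consecutive-adjacent : ∀ i j → Consecutive G (suc (suc L)) i j → Adj (close z f (toℕ i)) (close z f (toℕ j))
    consecutive-adjacent i j (inj₁ e)                    = next (toℕ i) (toℕ j) e (position≤ j)
    consecutive-adjacent i j (inj₂ (inj₁ e))             = adj-sym (next (toℕ j) (toℕ i) e (position≤ i))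
    consecutive-adjacent i j (inj₂ (inj₂ (inj₁ (e , w)))) = wrap (toℕ i) (toℕ j) e w
    consecutive-adjacent i j (inj₂ (inj₂ (inj₂ (e , w)))) = adj-sym (wrap (toℕ j) (toℕ i) e w)

  cycle-chord-shortens : ∀ {z L f} → Arc z L f → HasChord G (suc (suc L)) (λ i → close z f (toℕ i)) →
    ShorterArc z L
  cycle-chord-shortens {z} {L} {f} A (i , j , e , non-consecutive) with <-cmp (toℕ i) (toℕ j)
  ... | tri< i<j _ _ = chord-shortens A (toℕ i) (toℕ j) i<j (position≤ j) e (non-consecutive ∘ inj₁)
                         λ (i≡0 , j≡L) → non-consecutive (inj₂ (inj₂ (inj₁ (i≡0 , cong suc j≡L))))
  ... | tri≈ _ i≡j _ = ⊥-elim (irrefl (subst (λ t → Adj (close z f (toℕ i)) (close z f t)) (sym i≡j) e))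
  ... | tri> _ _ j<i = chord-shortens A (toℕ j) (toℕ i) j<i (position≤ i) (adj-sym e) (non-consecutive ∘ inj₂ ∘ inj₁)
                         λ (j≡0 , i≡L) → non-consecutive (inj₂ (inj₂ (inj₂ (j≡0 , cong suc i≡L))))

  -- Chordality: every arc can be shortened (it repeats a vertex, or its closed-up cycle has a chord).
  shorten : ∀ {z} L {f} → Arc z L f → ShorterArc z L
  shorten zero                A = ⊥-elim (Arc.ends-differ A refl)
  shorten (suc zero)          A = ⊥-elim (Arc.ends-nonadj A (Arc.steps A 0 (s≤s z≤n)))
  shorten {z} (suc (suc m)) {f} A with repeats? f (suc (suc m))
  ... | yes (j , j≤ , i , i<j , e) = repeat-shortens A i<j (≤-pred j≤) e
  ... | no  no-repeat = cycle-chord-shortens A (chordal m (λ i → close z f (toℕ i)) (arc-cycle A no-repeat))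

  no-arc : ∀ {z} L {f} → ¬ Arc z L f
  no-arc {z} = <-rec (λ L → ∀ {f} → ¬ Arc z L f) λ L shorter-impossible A →
    let (L' , f' , L'<L , A') = shorten L A in shorter-impossible L'<L A'

  frame : Fin n → (ℕ → Fin n) → ℕ → Fin n → ℕ → Fin n
  frame x g len y zero = x
  frame x g len y (suc k) with k ≤? len
  ... | yes _ = g k
  ... | no  _ = y

  frame-inner : ∀ x g len y {k} → k ≤ len → frame x g len y (suc k) ≡ g k
  frame-inner x g len y {k} k≤ with k ≤? len
  ... | yes _  = refl
  ... | no  k≰ = contradiction k≤ k≰

  frame-last : ∀ x g len y → frame x g len y (suc (suc len)) ≡ y
  frame-last x g len y with suc len ≤? len
  ... | yes sl≤l = contradiction sl≤l (<-irrefl refl)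
  ... | no  _    = refl

  -- Two distinct non-adjacent neighbours x, y of a, joined through a set Q outside the closed
  -- neighbourhood of a, would form an arc around a; hence no such configuration exists.
  no-hole : ∀ {a x y dx dy} {Q : Fin n → Set} → (∀ {w} → Q w → w ≢ a × ¬ Adj a w) →
    Walk Q dx dy → Adj x dx → Adj dy y → Adj a x → Adj a y → x ≢ y → ¬ Adj x y → ⊥
  no-hole {a} {x} {y} {dx} {dy} {Q} outside W x~dx dy~y a~x a~y x≢y x≁y = no-arc (suc (suc len)) arc
    where
    open Walk W
    F : ℕ → Fin n
    F = frame x at len y
    inner : ∀ {k} → k ≤ len → F (suc k) ≡ at k
    inner = frame-inner x at len y
    last : F (suc (suc len)) ≡ y
    last = frame-last x at len y
    steps′ : ∀ k → k < suc (suc len) → Adj (F k) (F (suc k))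
    steps′ zero    _ = subst (Adj x) (sym (trans (inner z≤n) start)) x~dx
    steps′ (suc k) k< with m≤n⇒m<n∨m≡n (≤-pred (≤-pred k<))
    ... | inj₁ k<len = subst₂ Adj (sym (inner (<⇒≤ k<len))) (sym (inner k<len)) (steps k k<len)
    ... | inj₂ refl  = subst₂ Adj (sym (trans (inner ≤-refl) end)) (sym last) dy~y
    z-inner′ : ∀ k → 0 < k → k < suc (suc len) → ¬ Adj a (F k)
    z-inner′ (suc k) _ k< = subst (λ v → ¬ Adj a v) (sym (inner (≤-pred (≤-pred k<)))) (proj₂ (outside (inside k (≤-pred (≤-pred k<)))))
    avoids-a : ∀ k → k ≤ suc (suc len) → F k ≢ a
    avoids-a zero    _  refl = irrefl a~x
    avoids-a (suc k) k≤ with m≤n⇒m<n∨m≡n (≤-pred k≤)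
    ... | inj₁ k<sl = subst (_≢ a) (sym (inner (≤-pred k<sl))) (proj₁ (outside (inside k (≤-pred k<sl))))
    ... | inj₂ refl = subst (_≢ a) (sym last) (λ y≡a → irrefl (subst (Adj a) y≡a a~y))
    arc : Arc a (suc (suc len)) F
    arc = record
      { steps       = steps′
      ; z-start     = a~x
      ; z-end       = subst (Adj a) (sym last) a~y
      ; z-inner     = z-inner′
      ; avoids-z    = avoids-a
      ; ends-nonadj = subst (λ v → ¬ Adj x v) (sym last) x≁y
      ; ends-differ = subst (x ≢_) (sym last) x≢y
      }

-- Connected components of induced subgraphs G[R], computed by growing a connected set.
module Components {n : ℕ} (G : Graph n) where
  open Graph G renaming (sym to adj-sym)
  open Paths G

  record Component (R : Subset n) (c : Fin n) : Set where
    field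
      D         : Subset n
      D⊆R       : D ⊆ R
      c∈D       : c ∈ D
      closed    : ∀ {d u} → d ∈ D → u ∈ R → Adj d u → u ∈ D
      connected : ∀ {u} → u ∈ D → Reach G (_∈ D) c u

  Exit : Subset n → Subset n → Set
  Exit R X = ∃[ d ] ∃[ u ] (d ∈ X × u ∈ R × u ∉ X × Adj d u)

  exit? : ∀ R X → Dec (Exit R X)
  exit? R X = any? λ d → any? λ u → d ∈? X ×-dec u ∈? R ×-dec ¬? (u ∈? X) ×-dec adj? d u

  Grown : Subset n → Fin n → Subset n → Set
  Grown R c X = X ⊆ R × c ∈ X × (∀ {u} → u ∈ X → Reach G (_∈ X) c u)

  -- Add exit vertices until none is left; terminates since subsets cannot grow forever.
  grow : ∀ R c X → Grown R c X → Component R c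
  grow R c = WF.All.wfRec ⊃-wellFounded _ (λ X → Grown R c X → Component R c) extend
    where
    extend : ∀ X → (∀ {X'} → X ⊂ X' → Grown R c X' → Component R c) → Grown R c X → Component R c
    extend X grow-further (X⊆R , c∈X , conn) with exit? R X
    ... | no no-exit = record { D = X ; D⊆R = X⊆R ; c∈D = c∈X ; connected = conn ; closed = closed }
      where
      closed : ∀ {d u} → d ∈ X → u ∈ R → Adj d u → u ∈ X
      closed {d} {u} d∈ u∈R e = decidable-stable (u ∈? X) λ u∉ → no-exit (d , u , d∈ , u∈R , u∉ , e)
    ... | yes (d , u , d∈X , u∈R , u∉X , e) = grow-further X⊂X' (X'⊆R , x∈p∪q⁺ (inj₁ c∈X) , conn')
      where
      X' : Subset n
      X' = X ∪ ⁅ u ⁆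
      X⊂X' : X ⊂ X'
      X⊂X' = p⊆p∪q ⁅ u ⁆ , u , x∈p∪q⁺ (inj₂ (x∈⁅x⁆ u)) , u∉X
      X'⊆R : X' ⊆ R
      X'⊆R {w} w∈ with x∈p∪q⁻ X ⁅ u ⁆ w∈
      ... | inj₁ w∈X = X⊆R w∈X
      ... | inj₂ w∈u = subst (_∈ R) (sym (x∈⁅y⁆⇒x≡y u w∈u)) u∈R
      conn' : ∀ {w} → w ∈ X' → Reach G (_∈ X') c w
      conn' {w} w∈ with x∈p∪q⁻ X ⁅ u ⁆ w∈
      ... | inj₁ w∈X = reach-mono (λ q → x∈p∪q⁺ (inj₁ q)) (conn w∈X)
      ... | inj₂ w∈u = subst (Reach G (_∈ X') c) (sym (x∈⁅y⁆⇒x≡y u w∈u))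
                         (step (reach-mono (λ q → x∈p∪q⁺ (inj₁ q)) (conn d∈X)) e (x∈p∪q⁺ (inj₂ (x∈⁅x⁆ u))))

  component : ∀ R {c} → c ∈ R → Component R c
  component R {c} c∈R = grow R c ⁅ c ⁆ (single⊆R , x∈⁅x⁆ c , single-connected)
    where
    single⊆R : ⁅ c ⁆ ⊆ R
    single⊆R u∈ = subst (_∈ R) (sym (x∈⁅y⁆⇒x≡y c u∈)) c∈R
    single-connected : ∀ {u} → u ∈ ⁅ c ⁆ → Reach G (_∈ ⁅ c ⁆) c u
    single-connected u∈ = subst (Reach G (_∈ ⁅ c ⁆) c) (sym (x∈⁅y⁆⇒x≡y c u∈)) (here (x∈⁅x⁆ c))

module Dirac {n : ℕ} (G : Graph n) (chordal : Chordal G) where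
  open Graph G renaming (sym to adj-sym)
  open Paths G
  open Holes G chordal
  open Components G

  Simplicial : Subset n → Fin n → Set
  Simplicial S s = s ∈ S × (∀ {x y} → x ∈ S → y ∈ S → Adj s x → Adj s y → x ≢ y → Adj x y)

  Complete : Subset n → Set
  Complete S = ∀ {x y} → x ∈ S → y ∈ S → x ≢ y → Adj x y

  NonAdjacentPair : Subset n → Set
  NonAdjacentPair S = ∃[ x ] ∃[ y ] (x ∈ S × y ∈ S × x ≢ y × ¬ Adj x y)

  DiracProperty : Subset n → Set
  DiracProperty S = Complete S ⊎ ∃[ s ] ∃[ t ] (Simplicial S s × Simplicial S t × s ≢ t × ¬ Adj s t)

  complete-or-pair : ∀ S → Complete S ⊎ NonAdjacentPair S
  complete-or-pair S with any? (λ x → any? λ y → x ∈? S ×-dec y ∈? S ×-dec ¬? (x ≟ᶠ y) ×-dec ¬? (adj? x y))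
  ... | yes pair = inj₂ pair
  ... | no  none = inj₁ λ {x} {y} x∈ y∈ x≢y → decidable-stable (adj? x y) λ x≁y → none (x , y , x∈ , y∈ , x≢y , x≁y)

  Far : Fin n → Fin n → Set
  Far a w = w ≢ a × ¬ Adj a w

  far? : ∀ a w → Dec (Far a w)
  far? a w = ¬? (w ≟ᶠ a) ×-dec ¬? (adj? a w)

  -- Take the
  -- component D of c in G[S] minus the closed neighbourhood of a, and S' = D plus its
  -- neighbours in S.  Its boundary S' ∖ D is a clique (otherwise a hole through a), so a
  -- simplicial vertex of G[S'] lies in D, where it is simplicial in G[S] too.
  simplicial-far : ∀ S → (∀ {S'} → S' ⊂ S → DiracProperty S') →
    ∀ {a c} → a ∈ S → c ∈ S → Far a c → ∃[ s ] (Simplicial S s × Far a s)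
  simplicial-far S dirac-below {a} {c} a∈S c∈S c-far = result
    where
    R : Subset n
    R = S ∩ ⟦ far? a ⟧
    open Component (component R (x∈p∩q⁺ (c∈S , ∈⟦⟧⁺ (far? a) c-far)))
    D-far : ∀ {w} → w ∈ D → Far a w
    D-far w∈ = ∈⟦⟧⁻ (far? a) (proj₂ (x∈p∩q⁻ S _ (D⊆R w∈)))
    D⊆S : D ⊆ S
    D⊆S w∈ = proj₁ (x∈p∩q⁻ S _ (D⊆R w∈))
    Near : Fin n → Set
    Near w = w ∈ D ⊎ ∃[ d ] (d ∈ D × Adj d w)
    near? : ∀ w → Dec (Near w)
    near? w = w ∈? D ⊎-dec any? (λ d → d ∈? D ×-dec adj? d w)
    S' : Subset n
    S' = S ∩ ⟦ near? ⟧
    S'-near : ∀ {w} → w ∈ S' → w ∈ S × Near w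
    S'-near {w} w∈ with x∈p∩q⁻ S _ w∈
    ... | w∈S , w-near = w∈S , ∈⟦⟧⁻ near? w-near
    neighbour∈S' : ∀ {d w} → d ∈ D → w ∈ S → Adj d w → w ∈ S'
    neighbour∈S' d∈ w∈S e = x∈p∩q⁺ (w∈S , ∈⟦⟧⁺ near? (inj₂ (_ , d∈ , e)))
    a∉S' : a ∉ S'
    a∉S' a∈ with proj₂ (S'-near a∈)
    ... | inj₁ a∈D             = proj₁ (D-far a∈D) refl
    ... | inj₂ (d , d∈D , d~a) = proj₂ (D-far d∈D) (adj-sym d~a)
    S'⊂S : S' ⊂ S
    S'⊂S = (λ w∈ → proj₁ (S'-near w∈)) , a , a∈S , a∉S'
    -- a boundary vertex is adjacent to a (otherwise it would belong to the component D)
    boundary : ∀ {x} → x ∈ S' → x ∉ D → ∃[ d ] (d ∈ D × Adj d x × Adj a x)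
    boundary x∈ x∉D with S'-near x∈
    ... | _ , inj₁ x∈D = ⊥-elim (x∉D x∈D)
    ... | x∈S , inj₂ (d , d∈D , d~x) = d , d∈D , d~x , decidable-stable (adj? a _) λ a≁x →
            x∉D (closed d∈D (x∈p∩q⁺ (x∈S , ∈⟦⟧⁺ (far? a) (x≢a , a≁x))) d~x)
      where
      x≢a : _ ≢ a
      x≢a refl = proj₂ (D-far d∈D) (adj-sym d~x)
    boundary-clique : ∀ {x y} → x ∈ S' → x ∉ D → y ∈ S' → y ∉ D → x ≢ y → ¬ ¬ Adj x y
    boundary-clique x∈ x∉D y∈ y∉D x≢y x≁y with boundary x∈ x∉D | boundary y∈ y∉D
    ... | dx , dx∈ , dx~x , a~x | dy , dy∈ , dy~y , a~y =
      no-hole D-far (reach⇒walk (reach-trans (reach-sym (connected dx∈)) (connected dy∈)))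
              (adj-sym dx~x) dy~y a~x a~y x≢y x≁y
    lift : ∀ {s} → s ∈ D → Simplicial S' s → ∃[ s ] (Simplicial S s × Far a s)
    lift s∈D (_ , nbrs-adjacent) =
      _ , (D⊆S s∈D , λ x∈ y∈ s~x s~y → nbrs-adjacent (neighbour∈S' s∈D x∈ s~x) (neighbour∈S' s∈D y∈ s~y) s~x s~y)
        , D-far s∈D
    result : ∃[ s ] (Simplicial S s × Far a s)
    result with dirac-below S'⊂S
    ... | inj₁ complete = c , (c∈S , λ x∈ y∈ c~x c~y → complete (neighbour∈S' c∈D x∈ c~x) (neighbour∈S' c∈D y∈ c~y))
                        , c-far
    ... | inj₂ (s , t , s-simp , t-simp , s≢t , s≁t) with s ∈? D | t ∈? D
    ...   | yes s∈D | _       = lift s∈D s-simp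
    ...   | no  _   | yes t∈D = lift t∈D t-simp
    ...   | no  s∉D | no  t∉D = ⊥-elim (boundary-clique (proj₁ s-simp) s∉D (proj₁ t-simp) t∉D s≢t s≁t)

  dirac : ∀ S → DiracProperty S
  dirac = WF.All.wfRec ⊂-wellFounded _ DiracProperty from-proper-subsets
    where
    from-proper-subsets : ∀ S → (∀ {S'} → S' ⊂ S → DiracProperty S') → DiracProperty S
    from-proper-subsets S dirac-below with complete-or-pair S
    ... | inj₁ complete = inj₁ complete
    ... | inj₂ (x , y , x∈ , y∈ , x≢y , x≁y) with simplicial-far S dirac-below x∈ y∈ (x≢y ∘ sym , x≁y)
    ...   | s , s-simp , s≢x , x≁s with simplicial-far S dirac-below (proj₁ s-simp) x∈ (s≢x ∘ sym , x≁s ∘ adj-sym)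
    ...     | t , t-simp , t≢s , s≁t = inj₂ (s , t , s-simp , t-simp , t≢s ∘ sym , s≁t)

  simplicial-exists : ∀ S {v} → v ∈ S → ∃[ s ] Simplicial S s
  simplicial-exists S {v} v∈S with dirac S
  ... | inj₁ complete                  = v , v∈S , λ x∈ y∈ _ _ → complete x∈ y∈
  ... | inj₂ (s , _ , s-simp , _ , _) = s , s-simp

-- Colourings faithful to a vertex partition, built by repeatedly removing simplicial vertices.
-- The partition is given by the labelling p; clique-bound says a clique meets at most λ' parts.
module Colouring {n : ℕ} (G : Graph n) (chordal : Chordal G) (p : Fin n → ℕ) {λ' : ℕ}
  (clique-bound : ∀ (K : List (Fin n)) → IsClique G K →
                  ∀ (ls : List ℕ) → Unique ls → All (_∈ₗ map p K) ls → length ls ≤ λ') where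
  open Graph G renaming (sym to adj-sym)
  open Paths G
  open Dirac G chordal

  PartsConnected : Subset n → Set
  PartsConnected S = ∀ {u v} → u ∈ S → v ∈ S → p u ≡ p v → Reach G (λ w → w ∈ S × p w ≡ p u) u v

  record Faithful (S : Subset n) (col : Fin n → Fin λ') : Set where
    field
      on-parts     : ∀ {u v} → u ∈ S → v ∈ S → p u ≡ p v → col u ≡ col v
      across-edges : ∀ {u v} → u ∈ S → v ∈ S → Adj u v → p u ≢ p v → col u ≢ col v

  parts-connected-minus : ∀ {S s} → Simplicial S s → PartsConnected S → PartsConnected (S - s)
  parts-connected-minus {S} {s} (_ , clique) connected u∈ v∈ pu≡pv =
    reach-mono (λ ((w∈S , w-part) , w≢s) → x∈p∧x≢y⇒x∈p-y w∈S w≢s , w-part)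
      (bypass (λ x∈ y∈ → clique (proj₁ x∈) (proj₁ y∈))
              (connected (x∈p-y⇒x∈p u∈) (x∈p-y⇒x∈p v∈) pu≡pv) (x∈p-y⇒x≢y u∈) (x∈p-y⇒x≢y v∈))

  recolour : Fin n → Fin λ' → (Fin n → Fin λ') → Fin n → Fin λ'
  recolour s c col w with w ≟ᶠ s
  ... | yes _ = c
  ... | no  _ = col w

  recolour-view : ∀ {S s c col u} → u ∈ S →
    (u ≡ s × recolour s c col u ≡ c) ⊎ (u ∈ S - s × recolour s c col u ≡ col u)
  recolour-view {s = s} {u = u} u∈ with u ≟ᶠ s
  ... | yes u≡s = inj₁ (u≡s , refl)
  ... | no  u≢s = inj₂ (x∈p∧x≢y⇒x∈p-y u∈ u≢s , refl)

  extend-faithful : ∀ {S s col c} → Faithful (S - s) col →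
    (∀ {u} → u ∈ S - s → p u ≡ p s → col u ≡ c) →
    (∀ {v} → v ∈ S - s → Adj s v → p s ≢ p v → col v ≢ c) →
    Faithful S (recolour s c col)
  extend-faithful {S} {s} {col} {c} faithful agrees differs = record
    { on-parts = on-parts′ ; across-edges = across-edges′ }
    where
    open Faithful faithful
    new = recolour s c col
    on-parts′ : ∀ {u v} → u ∈ S → v ∈ S → p u ≡ p v → new u ≡ new v
    on-parts′ u∈ v∈ pu≡pv with recolour-view {S} {s} {c} {col} u∈ | recolour-view {S} {s} {c} {col} v∈
    ... | inj₁ (refl , eu) | inj₁ (refl , ev) = trans eu (sym ev)
    ... | inj₁ (refl , eu) | inj₂ (v∈′ , ev)  = trans eu (trans (sym (agrees v∈′ (sym pu≡pv))) (sym ev))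
    ... | inj₂ (u∈′ , eu)  | inj₁ (refl , ev) = trans eu (trans (agrees u∈′ pu≡pv) (sym ev))
    ... | inj₂ (u∈′ , eu)  | inj₂ (v∈′ , ev)  = trans eu (trans (on-parts u∈′ v∈′ pu≡pv) (sym ev))
    across-edges′ : ∀ {u v} → u ∈ S → v ∈ S → Adj u v → p u ≢ p v → new u ≢ new v
    across-edges′ u∈ v∈ e pu≢pv eq with recolour-view {S} {s} {c} {col} u∈ | recolour-view {S} {s} {c} {col} v∈
    ... | inj₁ (refl , eu) | inj₁ (refl , ev) = irrefl e
    ... | inj₁ (refl , eu) | inj₂ (v∈′ , ev)  = differs v∈′ e pu≢pv (trans (sym ev) (trans (sym eq) eu))
    ... | inj₂ (u∈′ , eu)  | inj₁ (refl , ev) = differs u∈′ (adj-sym e) (pu≢pv ∘ sym) (trans (sym eu) (trans eq ev))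
    ... | inj₂ (u∈′ , eu)  | inj₂ (v∈′ , ev)  = across-edges u∈′ v∈′ e pu≢pv (trans (sym eu) (trans eq ev))

  UsedNear : Subset n → Fin n → (Fin n → Fin λ') → Fin λ' → Set
  UsedNear T s col c = ∃[ w ] (w ∈ T × Adj s w × col w ≡ c)

  used-near? : ∀ T s col c → Dec (UsedNear T s col c)
  used-near? T s col c = any? (λ w → w ∈? T ×-dec adj? s w ×-dec col w ≟ᶠ c)

  free-or-exhausted : ∀ T s col → (∃[ c ] ¬ UsedNear T s col c) ⊎ (∀ c → UsedNear T s col c)
  free-or-exhausted T s col with all? (used-near? T s col)
  ... | yes all-used = inj₂ all-used
  ... | no  not-all  = inj₁ (¬∀⟶∃¬ λ' _ (used-near? T s col) not-all)

  -- If s is simplicial and alone in its part within S, its neighbours in S - s cannot use all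
  -- λ' colours: one neighbour of each colour together with s would be a clique meeting λ' + 1
  -- parts (distinct colours mean distinct parts, since col is faithful).
  palette-not-exhausted : ∀ {S s col} → Simplicial S s → Faithful (S - s) col →
    (∀ {u} → u ∈ S - s → p u ≢ p s) → ¬ (∀ c → UsedNear (S - s) s col c)
  palette-not-exhausted {S} {s} {col} (_ , clique) faithful alone used = 1+n≰n too-many-parts
    where
    open Faithful faithful
    wit : Fin λ' → Fin n
    wit c = proj₁ (used c)
    wit∈ : ∀ c → wit c ∈ S - s
    wit∈ c = proj₁ (proj₂ (used c))
    wit-adj : ∀ c → Adj s (wit c)
    wit-adj c = proj₁ (proj₂ (proj₂ (used c)))
    wit-col : ∀ c → col (wit c) ≡ c
    wit-col c = proj₂ (proj₂ (proj₂ (used c)))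
    parts-injective : ∀ {c c'} → p (wit c) ≡ p (wit c') → c ≡ c'
    parts-injective {c} {c'} e = trans (sym (wit-col c)) (trans (on-parts (wit∈ c) (wit∈ c') e) (wit-col c'))
    K : List (Fin n)
    K = s ∷ tabulateₗ wit
    ls : List ℕ
    ls = p s ∷ tabulateₗ (p ∘ wit)
    K-clique : IsClique G K
    K-clique = (Allₚ.tabulate⁺ (λ c s≡w → alone (wit∈ c) (cong p (sym s≡w))) ∷ Uniqueₚ.tabulate⁺ (parts-injective ∘ cong p))
             , (Allₚ.tabulate⁺ wit-adj ∷ AllPairsₚ.tabulate⁺ λ {c} {c'} c≢c' →
                  clique (x∈p-y⇒x∈p (wit∈ c)) (x∈p-y⇒x∈p (wit∈ c')) (wit-adj c) (wit-adj c')
                         (c≢c' ∘ parts-injective ∘ cong p))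
    ls-unique : Unique ls
    ls-unique = Allₚ.tabulate⁺ (λ c e → alone (wit∈ c) (sym e)) ∷ Uniqueₚ.tabulate⁺ parts-injective
    ls⊆parts-of-K : All (_∈ₗ map p K) ls
    ls⊆parts-of-K = here refl ∷ Allₚ.tabulate⁺ (λ c → there (∈-map⁺ p (∈-tabulate⁺ c)))
    too-many-parts : suc λ' ≤ λ'
    too-many-parts = subst (_≤ λ') (cong suc (length-tabulate (p ∘ wit))) (clique-bound K K-clique ls ls-unique ls⊆parts-of-K)

  -- If s shares its part with some u₀ ∈ S - s, give s the colour of u₀: its part reaches s
  -- through a neighbour x, and any neighbour v of s in another part is adjacent to x, hence
  -- coloured differently.  Otherwise use a colour missing from the neighbourhood of s.
  colour-simplicial : ∀ {S s col} → Simplicial S s → PartsConnected S → Faithful (S - s) col →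
    ∃[ col′ ] Faithful S col′
  colour-simplicial {S} {s} {col} s-simp@(s∈S , clique) connected faithful
    with any? (λ u → u ∈? S - s ×-dec p u ≟ p s)
  ... | yes (u₀ , u₀∈ , u₀-part) = recolour s (col u₀) col , extend-faithful faithful agrees differs
    where
    open Faithful faithful
    agrees : ∀ {u} → u ∈ S - s → p u ≡ p s → col u ≡ col u₀
    agrees u∈ pu≡ps = on-parts u∈ u₀∈ (trans pu≡ps (sym u₀-part))
    differs : ∀ {v} → v ∈ S - s → Adj s v → p s ≢ p v → col v ≢ col u₀
    differs {v} v∈ s~v ps≢pv colv≡colu₀
      with last-step (connected (x∈p-y⇒x∈p u₀∈) s∈S u₀-part) (x∈p-y⇒x≢y u₀∈)
    ... | x , (x∈S , x-part) , x~s =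
      across-edges x∈′ v∈ x~v px≢pv (trans (agrees x∈′ px≡ps) (sym colv≡colu₀))
      where
      px≡ps : p x ≡ p s
      px≡ps = trans x-part u₀-part
      px≢pv : p x ≢ p v
      px≢pv e = ps≢pv (trans (sym px≡ps) e)
      x∈′ : x ∈ S - s
      x∈′ = x∈p∧x≢y⇒x∈p-y x∈S λ { refl → irrefl x~s }
      x~v : Adj x v
      x~v = clique x∈S (x∈p-y⇒x∈p v∈) (adj-sym x~s) s~v (px≢pv ∘ cong p)
  ... | no alone with free-or-exhausted (S - s) s col
  ...   | inj₁ (c , unused) =
    recolour s c col , extend-faithful faithful
      (λ u∈ pu≡ps → ⊥-elim (alone (_ , u∈ , pu≡ps)))
      (λ v∈ s~v _ colv≡c → unused (_ , v∈ , s~v , colv≡c))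
  ...   | inj₂ exhausted =
    ⊥-elim (palette-not-exhausted s-simp faithful (λ u∈ pu≡ps → alone (_ , u∈ , pu≡ps)) exhausted)

  -- Peeling simplicial vertices: every S whose parts are connected has a faithful colouring
  -- (c₀ colours the vertices outside S).
  faithful-colouring : Fin λ' → ∀ S → PartsConnected S → ∃[ col ] Faithful S col
  faithful-colouring c₀ = WF.All.wfRec ⊂-wellFounded _ (λ S → PartsConnected S → ∃[ col ] Faithful S col) peel
    where
    peel : ∀ S → (∀ {S'} → S' ⊂ S → PartsConnected S' → ∃[ col ] Faithful S' col) →
           PartsConnected S → ∃[ col ] Faithful S col
    peel S colour-below connected with nonempty? S
    ... | no empty = (λ _ → c₀) , record { on-parts = λ u∈ → ⊥-elim (empty (_ , u∈))
                                           ; across-edges = λ u∈ → ⊥-elim (empty (_ , u∈)) }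
    ... | yes (v , v∈S) with simplicial-exists S v∈S
    ...   | s , s-simp with colour-below (x∈p⇒p-x⊂p (proj₁ s-simp)) (parts-connected-minus s-simp connected)
    ...     | col , faithful = colour-simplicial s-simp connected faithful

  monochromatic-within-part : ∀ {col v u} → Faithful ⊤ col → Reach G (λ w → col w ≡ col v) v u → p u ≡ p v
  monochromatic-within-part faithful (here _) = refl
  monochromatic-within-part faithful (step {v = w₁} {w = w₂} r e same-colour) with p w₁ ≟ p w₂
  ... | yes part-kept = trans (sym part-kept) (monochromatic-within-part faithful r)
  ... | no  part-changed =
    ⊥-elim (Faithful.across-edges faithful ∈⊤ ∈⊤ e part-changed (trans (reach-end r) (sym same-colour)))

-- A colouring faithful to the partition has its monochromatic components inside parts, so
-- they are no larger than C.
lemma2 : ∀ (n : ℕ) (G : Graph n) (λ' C : ℕ) →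
    Chordal G → HasPartition G λ' C → HasColoring G λ' C
lemma2 zero    G λ' C _       _ = (λ ()) , (λ ())
lemma2 (suc n) G λ' C chordal (p , parts-connected , parts-small , clique-bound) =
  col , λ v xs unique in-component → parts-small v xs unique (All.map (monochromatic-within-part faithful) in-component)
  where
  open Paths G
  open Colouring G chordal p clique-bound
  -- a single vertex is a clique meeting one part, so 1 ≤ λ'
  c₀ : Fin λ'
  c₀ = fromℕ< (clique-bound (zero ∷ []) (([] ∷ []) , ([] ∷ [])) (p zero ∷ []) ([] ∷ []) (here refl ∷ []))
  colouring : ∃[ col ] Faithful ⊤ col
  colouring = faithful-colouring c₀ ⊤ (λ _ _ e → reach-mono (∈⊤ ,_) (parts-connected _ _ e))
  col : Fin (suc n) → Fin λ'
  col = proj₁ colouring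
  faithful : Faithful ⊤ col
  faithful = proj₂ colouring
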